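{- Let $t\ge 1$ and let $T=(T_+,T_-)$ be a simple $[t]$-trade with $1.5\cdot 2^t<\mathrm{vol}(T)<2.5\cdot 2^t$ and $\mathrm{vol}(T)\neq 2^{t+1}$. Then $\mathrm{afrk}(T)\ge t+4$.
   Context: Let $V=\{1,\dots,v\}$. Subsets of $V$ are identified with their characteristic vectors in $\mathrm{GF}(2)^v$, so $2^V$ is a $v$-dimensional vector space over $\mathrm{GF}(2)$ whose addition is symmetric difference. A $[t]$-trade is a pair $T=(T_+,T_-)$ of disjoint finite multisets of subsets of $V$ (called blocks) such that for every $i\in\{0,1,\dots,t\}$, every $i$-subset of $V$ is contained in the same number of blocks of $T_+$ as of $T_-$ (counting multiplicity). It is simple if no block is repeated. Its volume is $\mathrm{vol}(T)=|T_+|=|T_-|$. For a simple $[t]$-trade, $\mathrm{afrk}(T)$ denotes the dimension of the affine span of $T_+\cup T_-$ in $\mathrm{GF}(2)^v$. -}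

module Defs where

open import Data.Nat using (ℕ; zero; suc; _+_; _*_; _^_; _<_; _≤_)
open import Data.Bool using (Bool; true; false; _xor_; if_then_else_)
open import Data.Vec using (Vec; []; _∷_; zipWith; replicate)
open import Data.List using (List; length; filter; _++_)
open import Data.List.Membership.Propositional using (_∈_)
open import Data.List.Relation.Unary.Unique.Propositional using (Unique)
open import Data.List.Relation.Unary.All using (All)
open import Data.Fin.Subset using (Subset; _⊆_; ∣_∣; ⊥)
open import Data.Fin.Subset.Properties using (_⊆?_)
open import Data.Product using (Σ; _×_)
open import Relation.Binary.PropositionalEquality using (_≡_; _≢_)
open import Relation.Nullary using (¬_)

-- Subsets of V = {1..v} are represented by Subset v = Vec Bool v,
-- i.e. characteristic vectors in GF(2)^v.

_⊕_ : ∀ {v} → Subset v → Subset v → Subset v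
_⊕_ = zipWith _xor_

lincomb : ∀ {v d} → Vec Bool d → Vec (Subset v) d → Subset v
lincomb []      []       = ⊥
lincomb (c ∷ cs) (w ∷ ws) = if c then w ⊕ lincomb cs ws else lincomb cs ws

LinIndep : ∀ {v d} → Vec (Subset v) d → Set
LinIndep {d = d} ws = (c : Vec Bool d) → c ≢ replicate d false → lincomb c ws ≢ ⊥

diffs : ∀ {v d} → Subset v → Vec (Subset v) d → Vec (Subset v) d
diffs p₀ []       = []
diffs p₀ (p ∷ ps) = (p ⊕ p₀) ∷ diffs p₀ ps

AllVec : ∀ {A : Set} {d} → (A → Set) → Vec A d → Set
AllVec P []       = Data.Unit.⊤ where import Data.Unit
AllVec P (x ∷ xs) = P x × AllVec P xs

AffIndepIn : ∀ {v} → List (Subset v) → ℕ → Set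
AffIndepIn {v} S d =
  Σ (Subset v) λ p₀ → Σ (Vec (Subset v) d) λ ps →
    (p₀ ∈ S) × AllVec (_∈ S) ps × LinIndep (diffs p₀ ps)

-- A (finite) multiset of blocks is a list; a trade is a pair of lists.
record Trade (v : ℕ) : Set where
  constructor mkTrade
  field
    T₊ : List (Subset v)
    T₋ : List (Subset v)
open Trade public

count : ∀ {v} → Subset v → List (Subset v) → ℕ
count S B = length (filter (S ⊆?_) B)

IsTrade : ∀ {v} → ℕ → Trade v → Set
IsTrade {v} t T =
    ((B : Subset v) → B ∈ T₊ T → ¬ (B ∈ T₋ T))
  × ((i : ℕ) → i ≤ t → (S : Subset v) → ∣ S ∣ ≡ i → count S (T₊ T) ≡ count S (T₋ T))

IsSimple : ∀ {v} → Trade v → Set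
IsSimple T = Unique (T₊ T) × Unique (T₋ T)

vol : ∀ {v} → Trade v → ℕ
vol T = length (T₊ T)

-- afrk T ≡ d: d is the dimension of the affine span of T₊ ∪ T₋ in GF(2)^v,
-- i.e. the maximum d such that T₊ ∪ T₋ contains d+1 affinely independent points.
IsAfrk : ∀ {v} → Trade v → ℕ → Set
IsAfrk T d = AffIndepIn (T₊ T ++ T₋ T) d
           × ((e : ℕ) → AffIndepIn (T₊ T ++ T₋ T) e → e ≤ d)

{-# OPTIONS --safe #-}
-- Suppose afrk T ≤ t + 3. A coordinate can be dropped without identifying two blocks of T
-- unless two blocks differ only there, and then keeping it raises the affine rank; so some
-- set M of at most t + 3 coordinates separates the blocks. Projected onto M, T becomes the
-- function f = 𝟙(T₊) − 𝟙(T₋) on {0,1}^M, orthogonal to all monomials of degree ≤ t.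
-- Writing f₀, f₁ for the restrictions of f to the faces x₁ = 0 and x₁ = 1,
--   ⟨f, h⟩ = ⟨f₀ + f₁, h₀ + h₁⟩ − ⟨f₀ + f₁, h₁⟩ − ⟨f₁, h₀ + h₁⟩ + 2⟨f₁, h₁⟩,
-- where f₀ + f₁ is orthogonal to the same monomials as f and f₁ to those of one degree less.
-- By induction on the dimension m, 2^(a+b−m) divides ⟨f, h⟩ if f and h are orthogonal to all
-- monomials of degree < a and < b respectively, and 2^min(a, 2a+1−m) divides ⟨f, f⟩.
-- For a = t + 1 and m ≤ t + 3 this makes 2^t divide ⟨f, f⟩ = 2 vol T, and strictly between
-- 3·2^t and 5·2^t the only multiple of 2^t is 4·2^t, i.e. vol T = 2^(t+1).
module Submission where

open import Defs
open import Data.Bool using (Bool; true; false)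
import Data.Bool as Bool
open import Data.Bool.Properties using (xor-comm; xor-assoc; xor-identityʳ; xor-same)
open import Data.Empty using (⊥-elim)
import Data.Empty as Empty
open import Data.Fin.Subset using (Subset; ∣_∣; ⊥)
open import Data.Fin.Subset.Properties using (_⊆?_; ⊆-min; ∣⊥∣≡0)
open import Data.List using (List; []; _∷_; _++_; map; length)
open import Data.List.Membership.Propositional using (_∈_)
open import Data.List.Membership.Propositional.Properties using (∈-map⁺; ∈-map⁻)
open import Data.List.Properties using (filter-all; length-++; length-map; map-++)
open import Data.List.Relation.Unary.All as All using (All; []; _∷_)
import Data.List.Relation.Unary.All.Properties as All
open import Data.List.Relation.Unary.Any using (here; there)
open import Data.List.Relation.Unary.Unique.Propositional using (Unique; []; _∷_)
open import Data.List.Relation.Unary.Unique.Propositional.Properties using (++⁺)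
open import Data.Nat using (ℕ; zero; suc)
open import Data.Product using (Σ; ∃; _×_; _,_)
open import Data.Unit using (tt)
open import Data.Vec as Vec using (Vec; []; _∷_; tail; replicate)
open import Data.Vec.Properties
  using (≡-dec; ∷-injectiveˡ; ∷-injectiveʳ; zipWith-comm; zipWith-assoc; zipWith-identityʳ)
open import Effect.Monad using (RawMonad)
open import Level using (0ℓ)
open import Relation.Binary.PropositionalEquality
  using (_≡_; _≢_; refl; sym; trans; cong; cong₂; subst; subst₂; module ≡-Reasoning)
open import Relation.Nullary using (¬_; Dec; does; yes; no)
open import Relation.Nullary.Decidable using (decidable-stable; ¬¬-excluded-middle)
open import Relation.Nullary.Negation using (¬¬-Monad)

_≟_ : ∀ {n} (x y : Subset n) → Dec (x ≡ y)
_≟_ = ≡-dec Bool._≟_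

⊕-comm : ∀ {n} (x y : Subset n) → x ⊕ y ≡ y ⊕ x
⊕-comm = zipWith-comm xor-comm

⊕-assoc : ∀ {n} (x y z : Subset n) → (x ⊕ y) ⊕ z ≡ x ⊕ (y ⊕ z)
⊕-assoc = zipWith-assoc xor-assoc

⊕-identityʳ : ∀ {n} (x : Subset n) → x ⊕ ⊥ ≡ x
⊕-identityʳ = zipWith-identityʳ xor-identityʳ

⊕-identityˡ : ∀ {n} (x : Subset n) → ⊥ ⊕ x ≡ x
⊕-identityˡ x = trans (⊕-comm ⊥ x) (⊕-identityʳ x)

⊕-self : ∀ {n} (x : Subset n) → x ⊕ x ≡ ⊥
⊕-self []      = refl
⊕-self (a ∷ x) = cong₂ _∷_ (xor-same a) (⊕-self x)

⊕-left-comm : ∀ {n} (x y z : Subset n) → x ⊕ (y ⊕ z) ≡ y ⊕ (x ⊕ z)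
⊕-left-comm x y z = begin
  x ⊕ (y ⊕ z)  ≡⟨ ⊕-assoc x y z ⟨
  (x ⊕ y) ⊕ z  ≡⟨ cong (_⊕ z) (⊕-comm x y) ⟩
  (y ⊕ x) ⊕ z  ≡⟨ ⊕-assoc y x z ⟩
  y ⊕ (x ⊕ z)  ∎
  where open ≡-Reasoning

⊕-involutiveʳ : ∀ {n} (x z : Subset n) → (x ⊕ z) ⊕ z ≡ x
⊕-involutiveʳ x z = trans (⊕-assoc x z z) (trans (cong (x ⊕_) (⊕-self z)) (⊕-identityʳ x))

⊕-cancelʳ : ∀ {n} (x y z : Subset n) → x ⊕ z ≡ y ⊕ z → x ≡ y
⊕-cancelʳ x y z eq = begin
  x            ≡⟨ ⊕-involutiveʳ x z ⟨
  (x ⊕ z) ⊕ z  ≡⟨ cong (_⊕ z) eq ⟩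
  (y ⊕ z) ⊕ z  ≡⟨ ⊕-involutiveʳ y z ⟩
  y            ∎
  where open ≡-Reasoning

⊕≡⊥⇒≡ : ∀ {n} (x y : Subset n) → x ⊕ y ≡ ⊥ → x ≡ y
⊕≡⊥⇒≡ x y eq = ⊕-cancelʳ x y y (trans eq (sym (⊕-self y)))

tail-⊕ : ∀ {n} (x y : Subset (suc n)) → tail (x ⊕ y) ≡ tail x ⊕ tail y
tail-⊕ (a ∷ x) (b ∷ y) = refl

lincomb-⊕ : ∀ {v d} (c c′ : Vec Bool d) (ws : Vec (Subset v) d) →
            lincomb (c ⊕ c′) ws ≡ lincomb c ws ⊕ lincomb c′ ws
lincomb-⊕ []          []           []       = sym (⊕-self ⊥)
lincomb-⊕ (false ∷ c) (false ∷ c′) (w ∷ ws) = lincomb-⊕ c c′ ws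
lincomb-⊕ (false ∷ c) (true  ∷ c′) (w ∷ ws) =
  trans (cong (w ⊕_) (lincomb-⊕ c c′ ws)) (⊕-left-comm w (lincomb c ws) (lincomb c′ ws))
lincomb-⊕ (true  ∷ c) (false ∷ c′) (w ∷ ws) =
  trans (cong (w ⊕_) (lincomb-⊕ c c′ ws)) (sym (⊕-assoc w (lincomb c ws) (lincomb c′ ws)))
lincomb-⊕ {v} (true ∷ c) (true ∷ c′) (w ∷ ws) = begin
  lincomb (c ⊕ c′) ws  ≡⟨ lincomb-⊕ c c′ ws ⟩
  a ⊕ b                ≡⟨ ⊕-identityˡ (a ⊕ b) ⟨
  ⊥ ⊕ (a ⊕ b)          ≡⟨ cong (_⊕ (a ⊕ b)) (⊕-self w) ⟨
  (w ⊕ w) ⊕ (a ⊕ b)    ≡⟨ ⊕-assoc w w (a ⊕ b) ⟩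
  w ⊕ (w ⊕ (a ⊕ b))    ≡⟨ cong (w ⊕_) (⊕-left-comm w a b) ⟩
  w ⊕ (a ⊕ (w ⊕ b))    ≡⟨ ⊕-assoc w a (w ⊕ b) ⟨
  (w ⊕ a) ⊕ (w ⊕ b)    ∎
  where
  open ≡-Reasoning
  a b : Subset v
  a = lincomb c ws
  b = lincomb c′ ws

lincomb-injective : ∀ {v d} {ws : Vec (Subset v) d} → LinIndep ws →
                    ∀ c c′ → lincomb c ws ≡ lincomb c′ ws → c ≡ c′
lincomb-injective {ws = ws} indep c c′ eq = decidable-stable (c ≟ c′) λ c≢c′ →
  indep (c ⊕ c′) (λ c⊕c′≡0 → c≢c′ (⊕≡⊥⇒≡ c c′ c⊕c′≡0))
        (trans (lincomb-⊕ c c′ ws) (trans (cong (_⊕ lincomb c′ ws) eq) (⊕-self (lincomb c′ ws))))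

tail-lincomb : ∀ {v d} (c : Vec Bool d) (ws : Vec (Subset (suc v)) d) →
               tail (lincomb c ws) ≡ lincomb c (Vec.map tail ws)
tail-lincomb []          []       = refl
tail-lincomb (false ∷ c) (w ∷ ws) = tail-lincomb c ws
tail-lincomb (true  ∷ c) (w ∷ ws) = trans (tail-⊕ w (lincomb c ws)) (cong (tail w ⊕_) (tail-lincomb c ws))

LinIndep-from-tails : ∀ {v d} {ws : Vec (Subset (suc v)) d} → LinIndep (Vec.map tail ws) → LinIndep ws
LinIndep-from-tails {ws = ws} indep c c≢0 eq = indep c c≢0 (trans (sym (tail-lincomb c ws)) (cong tail eq))

diffs-map-tail : ∀ {v d} (p : Subset (suc v)) (ps : Vec (Subset (suc v)) d) →
                 diffs (tail p) (Vec.map tail ps) ≡ Vec.map tail (diffs p ps)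
diffs-map-tail p []       = refl
diffs-map-tail p (q ∷ ps) = cong₂ _∷_ (sym (tail-⊕ q p)) (diffs-map-tail p ps)

dependent-in-span : ∀ {v d} {w : Subset v} {ws : Vec (Subset v) d} → LinIndep ws →
                    ∀ c → c ≢ replicate (suc d) false → lincomb c (w ∷ ws) ≡ ⊥ →
                    ∃ λ cs → w ≡ lincomb cs ws
dependent-in-span indep (false ∷ cs) c≢0 dep =
  ⊥-elim (indep cs (λ cs≡0 → c≢0 (cong (false ∷_) cs≡0)) dep)
dependent-in-span indep (true  ∷ cs) _   dep = cs , ⊕≡⊥⇒≡ _ _ dep

tail-injective-on-span : ∀ {v d} {ws : Vec (Subset (suc v)) d} → LinIndep (Vec.map tail ws) →
                         ∀ cs cs′ → tail (lincomb cs ws) ≡ tail (lincomb cs′ ws) →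
                         lincomb cs ws ≡ lincomb cs′ ws
tail-injective-on-span {ws = ws} indep cs cs′ eq = cong (λ c → lincomb c ws)
  (lincomb-injective indep cs cs′ (trans (sym (tail-lincomb cs ws)) (trans eq (tail-lincomb cs′ ws))))

tail-twin-independent : ∀ {v d} {w w′ : Subset (suc v)} {ws : Vec (Subset (suc v)) d} →
                        LinIndep (Vec.map tail ws) → w ≢ w′ → tail w ≡ tail w′ →
                        ¬ LinIndep (w ∷ ws) → LinIndep (w′ ∷ ws)
tail-twin-independent {w = w} {w′} {ws} indep w≢w′ tails ¬indep c′ c′≢0 dep′ = ¬indep λ c c≢0 dep →
  collide (dependent-in-span (LinIndep-from-tails indep) c c≢0 dep)
          (dependent-in-span (LinIndep-from-tails indep) c′ c′≢0 dep′)
  where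
  collide : (∃ λ cs → w ≡ lincomb cs ws) → (∃ λ cs′ → w′ ≡ lincomb cs′ ws) → Empty.⊥
  collide (cs , w≡) (cs′ , w′≡) = w≢w′ (begin
    w               ≡⟨ w≡ ⟩
    lincomb cs ws   ≡⟨ tail-injective-on-span indep cs cs′
                         (trans (cong tail (sym w≡)) (trans tails (cong tail w′≡))) ⟩
    lincomb cs′ ws  ≡⟨ w′≡ ⟨
    w′              ∎)
    where open ≡-Reasoning

restrict : ∀ {v} (M : Subset v) → Subset v → Subset ∣ M ∣
restrict []          []      = []
restrict (true  ∷ M) (b ∷ x) = b ∷ restrict M x
restrict (false ∷ M) (_ ∷ x) = restrict M x

embed : ∀ {v} (M : Subset v) → Subset ∣ M ∣ → Subset v
embed []          []      = []
embed (true  ∷ M) (s ∷ S) = s ∷ embed M S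
embed (false ∷ M) S       = false ∷ embed M S

∣embed∣ : ∀ {v} (M : Subset v) (S : Subset ∣ M ∣) → ∣ embed M S ∣ ≡ ∣ S ∣
∣embed∣ []          []          = refl
∣embed∣ (true  ∷ M) (true  ∷ S) = cong suc (∣embed∣ M S)
∣embed∣ (true  ∷ M) (false ∷ S) = ∣embed∣ M S
∣embed∣ (false ∷ M) S           = ∣embed∣ M S

⊆?-restrict : ∀ {v} (M : Subset v) (S : Subset ∣ M ∣) x →
              does (S ⊆? restrict M x) ≡ does (embed M S ⊆? x)
⊆?-restrict []          []          []          = refl
⊆?-restrict (true  ∷ M) (false ∷ S) (b ∷ x)     = ⊆?-restrict M S x
⊆?-restrict (true  ∷ M) (true  ∷ S) (false ∷ x) = refl
⊆?-restrict (true  ∷ M) (true  ∷ S) (true  ∷ x) = ⊆?-restrict M S x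
⊆?-restrict (false ∷ M) S           (b ∷ x)     = ⊆?-restrict M S x

count-map-restrict : ∀ {v} (M : Subset v) (S : Subset ∣ M ∣) L →
                     count S (map (restrict M) L) ≡ count (embed M S) L
count-map-restrict M S []      = refl
count-map-restrict M S (x ∷ L) rewrite ⊆?-restrict M S x with does (embed M S ⊆? x)
... | true  = cong suc (count-map-restrict M S L)
... | false = count-map-restrict M S L

InjectiveOn : ∀ {A B : Set} → (A → B) → List A → Set
InjectiveOn f L = ∀ {x y} → x ∈ L → y ∈ L → f x ≡ f y → x ≡ y

Unique-map⁺ : ∀ {A B : Set} {f : A → B} {L} → InjectiveOn f L → Unique L → Unique (map f L)
Unique-map⁺ {L = []}    inj []         = []
Unique-map⁺ {L = x ∷ L} inj (x∉L ∷ uL) =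
  All.map⁺ (All.tabulate λ y∈L fx≡fy → All.lookup x∉L y∈L (inj (here refl) (there y∈L) fx≡fy))
  ∷ Unique-map⁺ (λ x∈ y∈ → inj (there x∈) (there y∈)) uL

record SeparatingCoordinates {v} (L : List (Subset v)) : Set where
  constructor separating
  field
    coordinates : Subset v
    injective   : InjectiveOn (restrict coordinates) L
    independent : AffIndepIn L ∣ coordinates ∣

TailClash : ∀ {v} → List (Subset (suc v)) → Set
TailClash L = ∃ λ x → ∃ λ y → x ∈ L × y ∈ L × x ≢ y × tail x ≡ tail y

lift-members : ∀ {v d} (L : List (Subset (suc v))) (ps′ : Vec (Subset v) d) → AllVec (_∈ map tail L) ps′ →
               Σ (Vec (Subset (suc v)) d) λ ps → AllVec (_∈ L) ps × Vec.map tail ps ≡ ps′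
lift-members L []         _            = [] , tt , refl
lift-members L (p′ ∷ ps′) (p′∈ , ps′∈) with ∈-map⁻ tail p′∈ | lift-members L ps′ ps′∈
... | p , p∈ , refl | ps , ps∈ , refl = p ∷ ps , (p∈ , ps∈) , refl

-- The case distinctions below (is there a clash? is the family independent?) are classical,
-- so the coordinates are only obtained under a double negation.
open RawMonad (¬¬-Monad {0ℓ})

add-coordinate : ∀ {v} (L : List (Subset (suc v))) (M : Subset v) → InjectiveOn (restrict M) (map tail L) →
                 AffIndepIn (map tail L) ∣ M ∣ → ¬ ¬ SeparatingCoordinates L
add-coordinate L M inj (p₀′ , ps′ , p₀′∈ , ps′∈ , indep′)
  with ∈-map⁻ tail p₀′∈ | lift-members L ps′ ps′∈
... | p₀ , p₀∈ , refl | ps , ps∈ , refl = do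
  yes (x , y , x∈ , y∈ , x≢y , tails) ← ¬¬-excluded-middle {A = TailClash L}
    where no no-clash → pure (separating (false ∷ M) (drop-injective no-clash)
                                          (p₀ , ps , p₀∈ , ps∈ , LinIndep-from-tails indep))
  yes indep-x ← ¬¬-excluded-middle {A = LinIndep (diffs p₀ (x ∷ ps))}
    where no ¬indep-x → pure (separating (true ∷ M) keep-injective
                                (p₀ , y ∷ ps , p₀∈ , (y∈ , ps∈) ,
                                 tail-twin-independent indep (λ eq → x≢y (⊕-cancelʳ x y p₀ eq))
                                                       (tails-⊕ x y tails) ¬indep-x))
  pure (separating (true ∷ M) keep-injective (p₀ , x ∷ ps , p₀∈ , (x∈ , ps∈) , indep-x))
  where
  indep : LinIndep (Vec.map tail (diffs p₀ ps))
  indep = subst LinIndep (diffs-map-tail p₀ ps) indep′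
  tails-⊕ : ∀ x y → tail x ≡ tail y → tail (x ⊕ p₀) ≡ tail (y ⊕ p₀)
  tails-⊕ x y eq = trans (tail-⊕ x p₀) (trans (cong (_⊕ tail p₀) eq) (sym (tail-⊕ y p₀)))
  keep-injective : InjectiveOn (restrict (true ∷ M)) L
  keep-injective {a ∷ x} {b ∷ y} x∈ y∈ eq =
    cong₂ _∷_ (∷-injectiveˡ eq) (inj (∈-map⁺ tail x∈) (∈-map⁺ tail y∈) (∷-injectiveʳ eq))
  drop-injective : ¬ TailClash L → InjectiveOn (restrict (false ∷ M)) L
  drop-injective no-clash {a ∷ x} {b ∷ y} x∈ y∈ eq = decidable-stable ((a ∷ x) ≟ (b ∷ y)) λ x≢y →
    no-clash (_ , _ , x∈ , y∈ , x≢y , inj (∈-map⁺ tail x∈) (∈-map⁺ tail y∈) eq)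

separating-coordinates : ∀ {v} (L : List (Subset v)) {p} → p ∈ L → ¬ ¬ SeparatingCoordinates L
separating-coordinates {zero}  L {p} p∈L =
  pure (separating [] (λ { {[]} {[]} _ _ _ → refl }) (p , [] , p∈L , tt , λ { [] []≢0 _ → []≢0 refl }))
separating-coordinates {suc v} L p∈L = do
  separating M inj family ← separating-coordinates (map tail L) (∈-map⁺ tail p∈L)
  add-coordinate L M inj family

module CubeAnalysis where

  open import Data.Integer using (ℤ; +_; 0ℤ; 1ℤ; _+_; _*_; _-_; -_; _^_)
  open import Data.Integer.Divisibility.Signed
    using (_∣_; ∣ᵤ⇒∣; ∣m∣n⇒∣m+n; ∣m+n∣n⇒∣m; ∣m⇒∣m*n; ∣n⇒∣m*n; *-monoʳ-∣)
  open import Data.Integer.Properties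
    using (+-identityˡ; +-identityʳ; +-inverseʳ; *-zeroˡ; *-zeroʳ; *-identityˡ; *-identityʳ; *-comm;
           *-distribˡ-+; neg-distrib-+; neg-distribʳ-*; pos-*)
  open import Data.Integer.Tactic.RingSolver using (solve-∀)
  open import Data.Nat as ℕ using (pred; z≤n; s≤s)
  import Data.Nat.Divisibility as ℕ
  import Data.Nat.Properties as ℕ

  𝟙 : Bool → ℕ
  𝟙 true  = 1
  𝟙 false = 0

  face₀ face₁ : ∀ {m} {A : Set} → (Subset (suc m) → A) → Subset m → A
  face₀ F x = F (false ∷ x)
  face₁ F x = F (true ∷ x)

  ∑ : ∀ {m} → (Subset m → ℤ) → ℤ
  ∑ {zero}  F = F []
  ∑ {suc m} F = ∑ (face₀ F) + ∑ (face₁ F)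

  ∑-cong : ∀ {m} {F G : Subset m → ℤ} → (∀ x → F x ≡ G x) → ∑ F ≡ ∑ G
  ∑-cong {zero}  F≗G = F≗G []
  ∑-cong {suc m} F≗G = cong₂ _+_ (∑-cong λ x → F≗G (false ∷ x)) (∑-cong λ x → F≗G (true ∷ x))

  ∑-zero : ∀ {m} {F : Subset m → ℤ} → (∀ x → F x ≡ 0ℤ) → ∑ F ≡ 0ℤ
  ∑-zero {zero}  F≗0 = F≗0 []
  ∑-zero {suc m} F≗0 = cong₂ _+_ (∑-zero λ x → F≗0 (false ∷ x)) (∑-zero λ x → F≗0 (true ∷ x))

  ∑-+ : ∀ {m} (F G : Subset m → ℤ) → ∑ (λ x → F x + G x) ≡ ∑ F + ∑ G
  ∑-+ {zero}  F G = refl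
  ∑-+ {suc m} F G = begin
    ∑ (λ x → face₀ F x + face₀ G x) + ∑ (λ x → face₁ F x + face₁ G x)
      ≡⟨ cong₂ _+_ (∑-+ (face₀ F) (face₀ G)) (∑-+ (face₁ F) (face₁ G)) ⟩
    (∑ (face₀ F) + ∑ (face₀ G)) + (∑ (face₁ F) + ∑ (face₁ G))
      ≡⟨ interchange (∑ (face₀ F)) (∑ (face₀ G)) (∑ (face₁ F)) (∑ (face₁ G)) ⟩
    (∑ (face₀ F) + ∑ (face₁ F)) + (∑ (face₀ G) + ∑ (face₁ G))
      ∎
    where
    open ≡-Reasoning
    interchange : ∀ a b c d → (a + b) + (c + d) ≡ (a + c) + (b + d)
    interchange = solve-∀

  ∑-*ˡ : ∀ {m} c (F : Subset m → ℤ) → ∑ (λ x → c * F x) ≡ c * ∑ F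
  ∑-*ˡ {zero}  c F = refl
  ∑-*ˡ {suc m} c F = trans (cong₂ _+_ (∑-*ˡ c (face₀ F)) (∑-*ˡ c (face₁ F))) (sym (*-distribˡ-+ c _ _))

  ∑-neg : ∀ {m} (F : Subset m → ℤ) → ∑ (λ x → - F x) ≡ - ∑ F
  ∑-neg {zero}  F = refl
  ∑-neg {suc m} F =
    trans (cong₂ _+_ (∑-neg (face₀ F)) (∑-neg (face₁ F))) (sym (neg-distrib-+ (∑ (face₀ F)) (∑ (face₁ F))))

  ∑-δ : ∀ {m} (F : Subset m → ℤ) b → ∑ (λ x → F x * + 𝟙 (does (b ≟ x))) ≡ F b
  ∑-δ {zero}  F []          = *-identityʳ (F [])
  ∑-δ {suc m} F (false ∷ b) =
    trans (cong₂ _+_ (∑-δ (face₀ F) b) (∑-zero λ x → *-zeroʳ (F (true ∷ x)))) (+-identityʳ (F (false ∷ b)))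
  ∑-δ {suc m} F (true  ∷ b) =
    trans (cong₂ _+_ (∑-zero λ x → *-zeroʳ (F (false ∷ x))) (∑-δ (face₁ F) b)) (+-identityˡ (F (true ∷ b)))

  ⟨_,_⟩ : ∀ {m} → (Subset m → ℤ) → (Subset m → ℤ) → ℤ
  ⟨ f , h ⟩ = ∑ (λ x → f x * h x)

  ⟨⟩-comm : ∀ {m} (f h : Subset m → ℤ) → ⟨ f , h ⟩ ≡ ⟨ h , f ⟩
  ⟨⟩-comm f h = ∑-cong (λ x → *-comm (f x) (h x))

  marginal : ∀ {m} → (Subset (suc m) → ℤ) → Subset m → ℤ
  marginal f x = face₀ f x + face₁ f x

  -- The splitting identity, stated without subtraction by moving the cross terms to the left.
  ⟨⟩-decomposition : ∀ {m} (f h : Subset (suc m) → ℤ) →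
    ⟨ f , h ⟩ + (⟨ marginal f , face₁ h ⟩ + ⟨ face₁ f , marginal h ⟩)
      ≡ ⟨ marginal f , marginal h ⟩ + + 2 * ⟨ face₁ f , face₁ h ⟩
  ⟨⟩-decomposition {m} f h = begin
    (∑ f₀h₀ + ∑ f₁h₁) + (∑ fh₁ + ∑ f₁h)
      ≡⟨ cong₂ _+_ (∑-+ f₀h₀ f₁h₁) (∑-+ fh₁ f₁h) ⟨
    ∑ (λ x → f₀h₀ x + f₁h₁ x) + ∑ (λ x → fh₁ x + f₁h x)
      ≡⟨ ∑-+ (λ x → f₀h₀ x + f₁h₁ x) (λ x → fh₁ x + f₁h x) ⟨
    ∑ (λ x → (f₀h₀ x + f₁h₁ x) + (fh₁ x + f₁h x))
      ≡⟨ ∑-cong (λ x → pointwise (face₀ f x) (face₁ f x) (face₀ h x) (face₁ h x)) ⟩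
    ∑ (λ x → fh x + + 2 * f₁h₁ x)
      ≡⟨ ∑-+ fh (λ x → + 2 * f₁h₁ x) ⟩
    ∑ fh + ∑ (λ x → + 2 * f₁h₁ x)
      ≡⟨ cong (_+_ (∑ fh)) (∑-*ˡ (+ 2) f₁h₁) ⟩
    ∑ fh + + 2 * ∑ f₁h₁
      ∎
    where
    open ≡-Reasoning
    f₀h₀ f₁h₁ fh₁ f₁h fh : Subset m → ℤ
    f₀h₀ x = face₀ f x * face₀ h x
    f₁h₁ x = face₁ f x * face₁ h x
    fh₁  x = marginal f x * face₁ h x
    f₁h  x = face₁ f x * marginal h x
    fh   x = marginal f x * marginal h x
    pointwise : ∀ a b c d → (a * c + b * d) + ((a + b) * d + b * (c + d)) ≡ (a + b) * (c + d) + + 2 * (b * d)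
    pointwise = solve-∀

  monomial : ∀ {m} → Subset m → Subset m → ℤ
  monomial S x = + 𝟙 (does (S ⊆? x))

  -- Strict bound: the signed function of a [t]-trade is Balanced (t + 1).
  Balanced : ∀ {m} → ℕ → (Subset m → ℤ) → Set
  Balanced {m} a f = (S : Subset m) → ∣ S ∣ ℕ.< a → ⟨ monomial S , f ⟩ ≡ 0ℤ

  marginal-balanced : ∀ {m} a (f : Subset (suc m) → ℤ) → Balanced a f → Balanced a (marginal f)
  marginal-balanced a f bal S ∣S∣<a = begin
    ⟨ monomial S , marginal f ⟩
      ≡⟨ ∑-cong (λ x → *-distribˡ-+ (monomial S x) _ _) ⟩
    ∑ (λ x → monomial S x * face₀ f x + monomial S x * face₁ f x)
      ≡⟨ ∑-+ (λ x → monomial S x * face₀ f x) (λ x → monomial S x * face₁ f x) ⟩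
    ⟨ monomial (false ∷ S) , f ⟩
      ≡⟨ bal (false ∷ S) ∣S∣<a ⟩
    0ℤ
      ∎
    where open ≡-Reasoning

  face₁-balanced : ∀ {m} a (f : Subset (suc m) → ℤ) → Balanced a f → Balanced (pred a) (face₁ f)
  face₁-balanced zero    f bal S ()
  face₁-balanced (suc a) f bal S ∣S∣<a = begin
    ⟨ monomial S , face₁ f ⟩
      ≡⟨ +-identityˡ _ ⟨
    0ℤ + ⟨ monomial S , face₁ f ⟩
      ≡⟨ cong (_+ ⟨ monomial S , face₁ f ⟩) (∑-zero (λ x → *-zeroˡ (f (false ∷ x)))) ⟨
    ⟨ monomial (true ∷ S) , f ⟩
      ≡⟨ bal (true ∷ S) (s≤s ∣S∣<a) ⟩
    0ℤ
      ∎
    where open ≡-Reasoning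

  balanced-dim0 : ∀ a (f : Subset 0 → ℤ) → Balanced (suc a) f → f [] ≡ 0ℤ
  balanced-dim0 a f bal = trans (sym (*-identityˡ (f []))) (bal [] (s≤s z≤n))

  ≤-pred-+ˡ : ∀ {n} a {b} → suc n ℕ.≤ a ℕ.+ b → n ℕ.≤ pred a ℕ.+ b
  ≤-pred-+ˡ zero    n<b         = ℕ.<⇒≤ n<b
  ≤-pred-+ˡ (suc a) (s≤s n≤a+b) = n≤a+b

  ≤-pred-+ʳ : ∀ {n} a b → suc n ℕ.≤ a ℕ.+ b → n ℕ.≤ a ℕ.+ pred b
  ≤-pred-+ʳ {n} a b n<a+b =
    subst (n ℕ.≤_) (ℕ.+-comm (pred b) a) (≤-pred-+ˡ b (subst (suc n ℕ.≤_) (ℕ.+-comm a b) n<a+b))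

  1∣_ : ∀ x → 1ℤ ∣ x
  1∣ x = ∣ᵤ⇒∣ (ℕ.1∣ _)

  ≡0⇒∣ : ∀ {k x} → x ≡ 0ℤ → k ∣ x
  ≡0⇒∣ refl = ∣ᵤ⇒∣ (_ ℕ.∣0)

  inner-divisible : ∀ {m} a b e (f h : Subset m → ℤ) → Balanced a f → Balanced b h →
                    e ℕ.+ m ℕ.≤ a ℕ.+ b → (+ 2) ^ e ∣ ⟨ f , h ⟩
  inner-divisible a b zero f h _ _ _ = 1∣ _
  inner-divisible {zero} (suc a) b    (suc e) f h bf _  _  = ∣m⇒∣m*n (h []) (≡0⇒∣ (balanced-dim0 a f bf))
  inner-divisible {zero} zero (suc b) (suc e) f h _  bh _  = ∣n⇒∣m*n (f []) (≡0⇒∣ (balanced-dim0 b h bh))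
  inner-divisible {zero} zero zero    (suc e) f h _  _  ()
  inner-divisible {suc m} a b (suc e) f h bf bh le =
    ∣m+n∣n⇒∣m (subst (_ ∣_) (sym (⟨⟩-decomposition f h)) (∣m∣n⇒∣m+n whole doubled))
              (∣m∣n⇒∣m+n cross₁ cross₂)
    where
    le′ : suc (suc (e ℕ.+ m)) ℕ.≤ a ℕ.+ b
    le′ = subst (λ k → suc k ℕ.≤ a ℕ.+ b) (ℕ.+-suc e m) le
    mf : Balanced a (marginal f)
    mf = marginal-balanced a f bf
    mh : Balanced b (marginal h)
    mh = marginal-balanced b h bh
    f₁ : Balanced (pred a) (face₁ f)
    f₁ = face₁-balanced a f bf
    h₁ : Balanced (pred b) (face₁ h)
    h₁ = face₁-balanced b h bh
    whole : (+ 2) ^ suc e ∣ ⟨ marginal f , marginal h ⟩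
    whole = inner-divisible a b (suc e) _ _ mf mh (ℕ.<⇒≤ le′)
    doubled : (+ 2) ^ suc e ∣ + 2 * ⟨ face₁ f , face₁ h ⟩
    doubled = *-monoʳ-∣ (+ 2) (inner-divisible (pred a) (pred b) e _ _ f₁ h₁ (≤-pred-+ʳ (pred a) b (≤-pred-+ˡ a le′)))
    cross₁ : (+ 2) ^ suc e ∣ ⟨ marginal f , face₁ h ⟩
    cross₁ = inner-divisible a (pred b) (suc e) _ _ mf h₁ (≤-pred-+ʳ a b le′)
    cross₂ : (+ 2) ^ suc e ∣ ⟨ face₁ f , marginal h ⟩
    cross₂ = inner-divisible (pred a) b (suc e) _ _ f₁ mh (≤-pred-+ˡ a le′)

  -- Against inner-divisible this gains a factor 2, because the two cross terms coincide.
  norm-divisible : ∀ {m} a e (f : Subset m → ℤ) → Balanced a f → e ℕ.≤ a →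
                   e ℕ.+ m ℕ.≤ suc (a ℕ.+ a) → (+ 2) ^ e ∣ ⟨ f , f ⟩
  norm-divisible a zero f _ _ _ = 1∣ _
  norm-divisible zero (suc e) f _ () _
  norm-divisible {zero} (suc a) (suc e) f bf _ _ = ∣m⇒∣m*n (f []) (≡0⇒∣ (balanced-dim0 a f bf))
  norm-divisible {suc m} (suc a) (suc e) f bf (s≤s e≤a) le =
    ∣m+n∣n⇒∣m (subst (_ ∣_) (sym (⟨⟩-decomposition f f)) (∣m∣n⇒∣m+n whole doubled)) cross
    where
    bound : e ℕ.+ m ℕ.≤ suc (a ℕ.+ a)
    bound = ℕ.s≤s⁻¹ (subst₂ ℕ._≤_ (ℕ.+-suc e m) (cong suc (ℕ.+-suc a a)) (ℕ.s≤s⁻¹ le))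
    mf : Balanced (suc a) (marginal f)
    mf = marginal-balanced (suc a) f bf
    f₁ : Balanced a (face₁ f)
    f₁ = face₁-balanced (suc a) f bf
    whole : (+ 2) ^ suc e ∣ ⟨ marginal f , marginal f ⟩
    whole = inner-divisible (suc a) (suc a) (suc e) _ _ mf mf (s≤s (subst (e ℕ.+ m ℕ.≤_) (sym (ℕ.+-suc a a)) bound))
    doubled : (+ 2) ^ suc e ∣ + 2 * ⟨ face₁ f , face₁ f ⟩
    doubled = *-monoʳ-∣ (+ 2) (norm-divisible a e (face₁ f) f₁ e≤a bound)
    cross-terms : ⟨ marginal f , face₁ f ⟩ + ⟨ face₁ f , marginal f ⟩ ≡ + 2 * ⟨ marginal f , face₁ f ⟩
    cross-terms = trans (cong (_+_ ⟨ marginal f , face₁ f ⟩) (⟨⟩-comm (face₁ f) (marginal f))) (double _)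
      where
      double : ∀ x → x + x ≡ + 2 * x
      double = solve-∀
    cross : (+ 2) ^ suc e ∣ ⟨ marginal f , face₁ f ⟩ + ⟨ face₁ f , marginal f ⟩
    cross = subst (_ ∣_) (sym cross-terms) (*-monoʳ-∣ (+ 2) (inner-divisible (suc a) a e _ _ mf f₁ bound))

  multiplicity : ∀ {m} → List (Subset m) → Subset m → ℕ
  multiplicity []      x = 0
  multiplicity (b ∷ L) x = 𝟙 (does (b ≟ x)) ℕ.+ multiplicity L x

  multiplicity-++ : ∀ {m} (A B : List (Subset m)) x →
                    multiplicity (A ++ B) x ≡ multiplicity A x ℕ.+ multiplicity B x
  multiplicity-++ []      B x = refl
  multiplicity-++ (a ∷ A) B x =
    trans (cong (𝟙 (does (a ≟ x)) ℕ.+_) (multiplicity-++ A B x)) (sym (ℕ.+-assoc (𝟙 (does (a ≟ x))) _ _))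

  multiplicity-∉ : ∀ {m} {x : Subset m} {L} → All (x ≢_) L → multiplicity L x ≡ 0
  multiplicity-∉ [] = refl
  multiplicity-∉ {x = x} {b ∷ L} (x≢b ∷ x∉L) with b ≟ x
  ... | yes refl = ⊥-elim (x≢b refl)
  ... | no _     = multiplicity-∉ x∉L

  Unique⇒multiplicity≤1 : ∀ {m} {x : Subset m} {L} → Unique L → multiplicity L x ℕ.≤ 1
  Unique⇒multiplicity≤1 {L = []} [] = z≤n
  Unique⇒multiplicity≤1 {x = x} {b ∷ L} (b∉L ∷ uL) with b ≟ x
  ... | yes refl = s≤s (ℕ.≤-reflexive (multiplicity-∉ b∉L))
  ... | no _     = Unique⇒multiplicity≤1 uL

  ∑-multiplicity : ∀ {m} (L : List (Subset m)) → ∑ (λ x → + multiplicity L x) ≡ + length L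
  ∑-multiplicity {m} []  = ∑-zero {m} (λ _ → refl)
  ∑-multiplicity (b ∷ L) = begin
    ∑ (λ x → + 𝟙 (does (b ≟ x)) + + multiplicity L x)
      ≡⟨ ∑-+ (λ x → + 𝟙 (does (b ≟ x))) (λ x → + multiplicity L x) ⟩
    ∑ (λ x → + 𝟙 (does (b ≟ x))) + ∑ (λ x → + multiplicity L x)
      ≡⟨ cong₂ _+_ (trans (∑-cong λ x → sym (*-identityˡ (+ 𝟙 (does (b ≟ x))))) (∑-δ (λ _ → 1ℤ) b))
                   (∑-multiplicity L) ⟩
    1ℤ + + length L
      ∎
    where open ≡-Reasoning

  count-∷ : ∀ {m} (S b : Subset m) L → + count S (b ∷ L) ≡ monomial S b + + count S L
  count-∷ S b L with does (S ⊆? b)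
  ... | true  = refl
  ... | false = refl

  moment-multiplicity : ∀ {m} (S : Subset m) L → ⟨ monomial S , (λ x → + multiplicity L x) ⟩ ≡ + count S L
  moment-multiplicity S []      = ∑-zero (λ x → *-zeroʳ (monomial S x))
  moment-multiplicity S (b ∷ L) = begin
    ∑ (λ x → monomial S x * (+ 𝟙 (does (b ≟ x)) + + multiplicity L x))
      ≡⟨ ∑-cong (λ x → *-distribˡ-+ (monomial S x) (+ 𝟙 (does (b ≟ x))) (+ multiplicity L x)) ⟩
    ∑ (λ x → monomial S x * + 𝟙 (does (b ≟ x)) + monomial S x * + multiplicity L x)
      ≡⟨ ∑-+ (λ x → monomial S x * + 𝟙 (does (b ≟ x))) (λ x → monomial S x * + multiplicity L x) ⟩
    ∑ (λ x → monomial S x * + 𝟙 (does (b ≟ x))) + ⟨ monomial S , (λ x → + multiplicity L x) ⟩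
      ≡⟨ cong₂ _+_ (∑-δ (monomial S) b) (moment-multiplicity S L) ⟩
    monomial S b + + count S L
      ≡⟨ count-∷ S b L ⟨
    + count S (b ∷ L)
      ∎
    where open ≡-Reasoning

  signed : ∀ {m} → List (Subset m) → List (Subset m) → Subset m → ℤ
  signed P N x = + multiplicity P x - + multiplicity N x

  signed-balanced : ∀ {m} t (P N : List (Subset m)) →
                    (∀ S → ∣ S ∣ ℕ.≤ t → count S P ≡ count S N) → Balanced (suc t) (signed P N)
  signed-balanced t P N same-counts S (s≤s ∣S∣≤t) = begin
    ⟨ monomial S , signed P N ⟩
      ≡⟨ ∑-cong (λ x → trans (*-distribˡ-+ (monomial S x) (+ multiplicity P x) (- + multiplicity N x))
                             (cong (_+_ (monomial S x * + multiplicity P x))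
                                   (sym (neg-distribʳ-* (monomial S x) (+ multiplicity N x))))) ⟩
    ∑ (λ x → monomial S x * + multiplicity P x + - (monomial S x * + multiplicity N x))
      ≡⟨ ∑-+ (λ x → monomial S x * + multiplicity P x) (λ x → - (monomial S x * + multiplicity N x)) ⟩
    ⟨ monomial S , (λ x → + multiplicity P x) ⟩ + ∑ (λ x → - (monomial S x * + multiplicity N x))
      ≡⟨ cong (_+_ ⟨ monomial S , (λ x → + multiplicity P x) ⟩) (∑-neg λ x → monomial S x * + multiplicity N x) ⟩
    ⟨ monomial S , (λ x → + multiplicity P x) ⟩ - ⟨ monomial S , (λ x → + multiplicity N x) ⟩
      ≡⟨ cong₂ _-_ (moment-multiplicity S P) (moment-multiplicity S N) ⟩
    + count S P - + count S N
      ≡⟨ cong (λ c → + count S P - + c) (same-counts S ∣S∣≤t) ⟨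
    + count S P - + count S P
      ≡⟨ +-inverseʳ (+ count S P) ⟩
    0ℤ
      ∎
    where open ≡-Reasoning

  bit-difference-square : ∀ p n → p ℕ.+ n ℕ.≤ 1 → (+ p - + n) * (+ p - + n) ≡ + (p ℕ.+ n)
  bit-difference-square 0             0             _           = refl
  bit-difference-square 1             0             _           = refl
  bit-difference-square 0             1             _           = refl
  bit-difference-square 0             (suc (suc n)) (s≤s ())
  bit-difference-square 1             (suc n)       (s≤s ())
  bit-difference-square (suc (suc p)) n             (s≤s ())

  signed-norm : ∀ {m} (P N : List (Subset m)) → Unique (P ++ N) →
                ⟨ signed P N , signed P N ⟩ ≡ + (length P ℕ.+ length N)
  signed-norm P N unique = begin
    ⟨ signed P N , signed P N ⟩          ≡⟨ ∑-cong square ⟩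
    ∑ (λ x → + multiplicity (P ++ N) x)  ≡⟨ ∑-multiplicity (P ++ N) ⟩
    + length (P ++ N)                    ≡⟨ cong +_ (length-++ P) ⟩
    + (length P ℕ.+ length N)            ∎
    where
    open ≡-Reasoning
    square : ∀ x → signed P N x * signed P N x ≡ + multiplicity (P ++ N) x
    square x = trans (bit-difference-square (multiplicity P x) (multiplicity N x)
                        (subst (ℕ._≤ 1) (multiplicity-++ P N x) (Unique⇒multiplicity≤1 unique)))
                     (cong +_ (sym (multiplicity-++ P N x)))

  pos-^ : ∀ n k → (+ n) ^ k ≡ + (n ℕ.^ k)
  pos-^ n zero    = refl
  pos-^ n (suc k) = trans (cong (+ n *_) (pos-^ n k)) (sym (pos-* n (n ℕ.^ k)))

open CubeAnalysis

open import Data.Integer using (ℤ; +_)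
open import Data.Integer.Divisibility.Signed as ℤ using (∣⇒∣ᵤ)
open import Data.Nat using (_+_; _*_; _^_; _<_; _≤_; _≤?_; z≤n; s≤s⁻¹)
open import Data.Nat.Divisibility using (_∣_; divides; _∣0; _∣?_)
open import Data.Nat.Properties
  using (+-comm; +-suc; +-identityʳ; +-monoʳ-≤; *-comm; *-assoc; *-cancelʳ-<; *-cancelˡ-≡;
         ^-distribˡ-+-*; ≤-trans; ≤-reflexive; ≤-antisym; n≤1+n; ≰⇒>)

count-⊥ : ∀ {v} (L : List (Subset v)) → count ⊥ L ≡ length L
count-⊥ L = cong length (filter-all (⊥ ⊆?_) (All.universal ⊆-min L))

length-T₋≡vol : ∀ {v} t (T : Trade v) → IsTrade t T → length (T₋ T) ≡ vol T
length-T₋≡vol {v} t T (_ , same-counts) =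
  trans (sym (count-⊥ (T₋ T))) (trans (sym (same-counts 0 z≤n ⊥ (∣⊥∣≡0 v))) (count-⊥ (T₊ T)))

projected-volume-divisible : ∀ {v} t (T : Trade v) → IsTrade t T → IsSimple T → (M : Subset v) →
                             InjectiveOn (restrict M) (T₊ T ++ T₋ T) → ∣ M ∣ ≤ 3 + t → 2 ^ t ∣ 2 * vol T
projected-volume-divisible t T trade@(disjoint , same-counts) (unique₊ , unique₋) M inj dim≤ =
  ∣⇒∣ᵤ (subst₂ ℤ._∣_ (pos-^ 2 t) norm≡ (norm-divisible (suc t) t f balanced (n≤1+n t) bound))
  where
  P N : List (Subset ∣ M ∣)
  P = map (restrict M) (T₊ T)
  N = map (restrict M) (T₋ T)
  f : Subset ∣ M ∣ → ℤ
  f = signed P N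
  balanced : Balanced (suc t) f
  balanced = signed-balanced t P N λ S ∣S∣≤t → begin
    count S P                 ≡⟨ count-map-restrict M S (T₊ T) ⟩
    count (embed M S) (T₊ T)  ≡⟨ same-counts ∣ embed M S ∣ (subst (_≤ t) (sym (∣embed∣ M S)) ∣S∣≤t) _ refl ⟩
    count (embed M S) (T₋ T)  ≡⟨ count-map-restrict M S (T₋ T) ⟨
    count S N                 ∎
    where open ≡-Reasoning
  unique : Unique (P ++ N)
  unique = subst Unique (map-++ (restrict M) (T₊ T) (T₋ T))
                 (Unique-map⁺ inj (++⁺ unique₊ unique₋ λ (x∈₊ , x∈₋) → disjoint _ x∈₊ x∈₋))
  norm≡ : ⟨ f , f ⟩ ≡ + (2 * vol T)
  norm≡ = begin
    ⟨ f , f ⟩                ≡⟨ signed-norm P N unique ⟩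
    + (length P + length N)  ≡⟨ cong +_ (cong₂ _+_ (length-map _ (T₊ T))
                                                  (trans (length-map _ (T₋ T)) (length-T₋≡vol t T trade))) ⟩
    + (vol T + vol T)        ≡⟨ cong (λ n → + (vol T + n)) (+-identityʳ (vol T)) ⟨
    + (2 * vol T)            ∎
    where open ≡-Reasoning
  bound : t + ∣ M ∣ ≤ suc (suc t + suc t)
  bound = ≤-trans (+-monoʳ-≤ t dim≤) (≤-reflexive (trans (+-suc t (suc (suc t))) (cong suc (+-suc t (suc t)))))

low-rank-volume-divisible : ∀ {v} t (T : Trade v) → IsTrade t T → IsSimple T →
                            (∀ e → AffIndepIn (T₊ T ++ T₋ T) e → e ≤ 3 + t) → 2 ^ t ∣ 2 * vol T
low-rank-volume-divisible t (mkTrade []      _) _ _ _ = (2 ^ t) ∣0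
low-rank-volume-divisible t T@(mkTrade (_ ∷ _) _) trade simple rank≤ =
  decidable-stable (2 ^ t ∣? 2 * vol T) λ ∤ →
    separating-coordinates (T₊ T ++ T₋ T) (here refl) λ (separating M inj family) →
      ∤ (projected-volume-divisible t T trade simple M inj (rank≤ ∣ M ∣ family))

multiple-between-3-and-5 : ∀ {k n} → k ∣ n → 3 * k < n → n < 5 * k → n ≡ 4 * k
multiple-between-3-and-5 {k} (divides q refl) 3k<qk qk<5k =
  cong (_* k) (≤-antisym (s≤s⁻¹ (*-cancelʳ-< k q 5 qk<5k)) (*-cancelʳ-< k 3 q 3k<qk))

theorem4p9 : (v t : ℕ) → 1 ≤ t → (T : Trade v) → IsTrade t T → IsSimple T →
    3 * 2 ^ t < 2 * vol T → 2 * vol T < 5 * 2 ^ t → vol T ≢ 2 ^ (t + 1) →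
    (d : ℕ) → IsAfrk T d → t + 4 ≤ d
theorem4p9 v t _ T trade simple lower upper vol≢ d (_ , maximal) =
  decidable-stable (t + 4 ≤? d) λ t+4≰d →
    vol≢ (halve (multiple-between-3-and-5 (low-rank-volume-divisible t T trade simple (rank≤ t+4≰d)) lower upper))
  where
  rank≤ : ¬ t + 4 ≤ d → ∀ e → AffIndepIn (T₊ T ++ T₋ T) e → e ≤ 3 + t
  rank≤ t+4≰d e family = ≤-trans (maximal e family) (s≤s⁻¹ (subst (suc d ≤_) (+-comm t 4) (≰⇒> t+4≰d)))
  halve : 2 * vol T ≡ 4 * 2 ^ t → vol T ≡ 2 ^ (t + 1)
  halve eq = trans (*-cancelˡ-≡ (vol T) (2 * 2 ^ t) 2 (trans eq (*-assoc 2 2 (2 ^ t))))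
                   (sym (trans (^-distribˡ-+-* 2 t 1) (*-comm (2 ^ t) 2)))
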